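{- Let $G$ be a cubic graph that has a 3-decomposition, let $u$ be a vertex of $G$ with neighbours $w_1,w_2,w_3$, and let $P$ be a copy of the Petersen graph with one vertex removed, whose three vertices of degree 2 are $p_1,p_2,p_3$. Let $H$ be the graph obtained from $G$ by deleting $u$, adding $P$ (on new vertices), and adding the edges $p_iw_i$ for $i=1,2,3$. Then $H$ has a 3-decomposition.
   Context: All graphs are finite and simple. A 3-decomposition of a graph $G$ is a triple $(T,C,M)$ of subgraphs such that every edge of $G$ lies in exactly one of them, $T$ is a spanning tree of $G$, $C$ is a (possibly empty) 2-regular graph, and $M$ is a (possibly empty) matching. -}

module Defs where

open import Data.Bool using (Bool; true; false; _∧_; _∨_; if_then_else_)
open import Data.Nat using (ℕ; zero; suc; _≤_; _≡ᵇ_)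
open import Data.Fin using (Fin; toℕ; punchIn)
import Data.Fin as Fin
open import Data.List using (List; []; _∷_; length; _++_; [_])
open import Data.List.Membership.Propositional using (_∈_)
open import Data.List.Relation.Unary.Unique.Propositional using (Unique)
open import Data.List.Relation.Unary.Linked using (Linked)
open import Data.Product using (Σ; _×_; _,_)
open import Data.Sum using (_⊎_; inj₁; inj₂)
open import Data.Empty using (⊥)
open import Relation.Nullary using (¬_)
open import Relation.Nullary.Decidable using (⌊_⌋)
open import Relation.Binary.PropositionalEquality using (_≡_)
open import Function.Bundles using (_⇔_)

Rel : Set → Set
Rel V = V → V → Bool

Adj : {V : Set} → Rel V → V → V → Set
Adj E x y = E x y ≡ true

record Graph (n : ℕ) : Set where
  field
    E     : Rel (Fin n)
    sym   : ∀ x y → E x y ≡ E y x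
    irrefl : ∀ x → E x x ≡ false
open Graph public

HasDegree : {V : Set} → Rel V → V → ℕ → Set
HasDegree {V} E v k =
  Σ (List V) λ ns → (length ns ≡ k) × Unique ns × (∀ w → (Adj E v w ⇔ (w ∈ ns)))

Cubic : {n : ℕ} → Graph n → Set
Cubic G = ∀ v → HasDegree (E G) v 3

data Walk {V : Set} (E : Rel V) : V → V → Set where
  here : ∀ {x} → Walk E x x
  step : ∀ {x y z} → Adj E x y → Walk E y z → Walk E x z

Connected : {V : Set} → Rel V → Set
Connected {V} E = ∀ (x y : V) → Walk E x y

Cycle : {V : Set} → Rel V → Set
Cycle {V} E =
  Σ V λ x → Σ (List V) λ xs →
    (2 ≤ length xs) × Unique (x ∷ xs) × Linked (Adj E) (x ∷ xs ++ [ x ])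

Acyclic : {V : Set} → Rel V → Set
Acyclic E = ¬ Cycle E

SpanningTree : {V : Set} → Rel V → Set
SpanningTree E = Connected E × Acyclic E

-- (Possibly empty) 2-regular subgraph: every vertex has degree 0 or 2
-- (vertices of degree 0 are exactly those not in the subgraph).
TwoRegular : {V : Set} → Rel V → Set
TwoRegular E = ∀ v → HasDegree E v 0 ⊎ HasDegree E v 2

Matching : {V : Set} → Rel V → Set
Matching E = ∀ v → HasDegree E v 0 ⊎ HasDegree E v 1

SymmetricRel : {V : Set} → Rel V → Set
SymmetricRel E = ∀ x y → E x y ≡ E y x

record ThreeDecomposition {V : Set} (E : Rel V) : Set where
  field
    T C M   : Rel V
    T-sym   : SymmetricRel T
    C-sym   : SymmetricRel C
    M-sym   : SymmetricRel M
    T⊆E     : ∀ x y → Adj T x y → Adj E x y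
    C⊆E     : ∀ x y → Adj C x y → Adj E x y
    M⊆E     : ∀ x y → Adj M x y → Adj E x y
    cover   : ∀ x y → Adj E x y → Adj T x y ⊎ Adj C x y ⊎ Adj M x y
    TC-disj : ∀ x y → Adj T x y → Adj C x y → ⊥
    TM-disj : ∀ x y → Adj T x y → Adj M x y → ⊥
    CM-disj : ∀ x y → Adj C x y → Adj M x y → ⊥
    T-tree  : SpanningTree T
    C-2reg  : TwoRegular C
    M-match : Matching M

-- The Petersen graph on Fin 10: outer 5-cycle 0-1-2-3-4-0, spokes
-- i -- i+5, inner pentagram 5-7-9-6-8-5.

petersenEdges : List (ℕ × ℕ)
petersenEdges =
  (0 , 1) ∷ (1 , 2) ∷ (2 , 3) ∷ (3 , 4) ∷ (4 , 0) ∷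
  (0 , 5) ∷ (1 , 6) ∷ (2 , 7) ∷ (3 , 8) ∷ (4 , 9) ∷
  (5 , 7) ∷ (7 , 9) ∷ (9 , 6) ∷ (6 , 8) ∷ (8 , 5) ∷ []

edgeℕ : List (ℕ × ℕ) → ℕ → ℕ → Bool
edgeℕ [] a b = false
edgeℕ ((x , y) ∷ es) a b =
  ((x ≡ᵇ a) ∧ (y ≡ᵇ b)) ∨ ((x ≡ᵇ b) ∧ (y ≡ᵇ a)) ∨ edgeℕ es a b

petersen : Rel (Fin 10)
petersen i j = edgeℕ petersenEdges (toℕ i) (toℕ j)

-- Petersen graph minus vertex 0, on Fin 9 (vertex i ↦ Petersen vertex i+1).
petersenMinus : Rel (Fin 9)
petersenMinus i j = petersen (punchIn Fin.zero i) (punchIn Fin.zero j)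

-- Its three vertices of degree 2: the former neighbours 1, 4, 5 of vertex 0.
p₁ p₂ p₃ : Fin 9
p₁ = Fin.fromℕ< {0} (Data.Nat.s≤s Data.Nat.z≤n)
p₂ = Fin.fromℕ< {3} (Data.Nat.s≤s (Data.Nat.s≤s (Data.Nat.s≤s (Data.Nat.s≤s Data.Nat.z≤n))))
p₃ = Fin.fromℕ< {4} (Data.Nat.s≤s (Data.Nat.s≤s (Data.Nat.s≤s (Data.Nat.s≤s (Data.Nat.s≤s Data.Nat.z≤n)))))

-- The graph H: delete u from G (its remaining vertices are Fin m, vertex a
-- of G - u being vertex punchIn u a of G), add P on new vertices, and add
-- the edges p_i w_i.

replacePetersen : {m : ℕ} → Graph (suc m) → (u : Fin (suc m)) →
                  (w₁ w₂ w₃ : Fin m) → Rel (Fin m ⊎ Fin 9)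
replacePetersen G u w₁ w₂ w₃ (inj₁ a) (inj₁ b) = E G (punchIn u a) (punchIn u b)
replacePetersen G u w₁ w₂ w₃ (inj₂ a) (inj₂ b) = petersenMinus a b
replacePetersen G u w₁ w₂ w₃ (inj₁ a) (inj₂ b) = link w₁ w₂ w₃ a b
  where
  link : ∀ {m} → Fin m → Fin m → Fin m → Fin m → Fin 9 → Bool
  link w₁ w₂ w₃ a b =
    (⌊ a Fin.≟ w₁ ⌋ ∧ ⌊ b Fin.≟ p₁ ⌋) ∨ (⌊ a Fin.≟ w₂ ⌋ ∧ ⌊ b Fin.≟ p₂ ⌋) ∨
    (⌊ a Fin.≟ w₃ ⌋ ∧ ⌊ b Fin.≟ p₃ ⌋)
replacePetersen G u w₁ w₂ w₃ (inj₂ b) (inj₁ a) = replacePetersen G u w₁ w₂ w₃ (inj₁ a) (inj₂ b)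

-- Colour each edge of G by the part T, C or M of the decomposition containing it.  At u, T
-- being spanning forces a tree edge, M being a matching allows at most one matching edge and C
-- being 2-regular allows zero or two cycle edges, so the edges u w₁, u w₂, u w₃ carry one of
-- seven colour profiles: TTT or an arrangement of TTM or TCC.  For each profile an explicit
-- colouring of P and of the links p_i w_i, verified by evaluation, extends the colouring of
-- G − u.  Cycle and matching degrees at old vertices survive (a matching edge at u may turn
-- into a tree link, which only lowers a matching degree).  The new tree is connected, since
-- every old vertex reaches P along T and the tree of P has a root.  It is acyclic because
-- contracting P onto u (its leaf, if any, onto the adjacent w_i) maps it into T, injectively
-- on the edges it does not collapse, while every collapsed edge separates its fibre.

module Submission where

open import Defs hiding (sym)
open import Data.Bool as Bool using (Bool; true; false; _∧_; _∨_; not; if_then_else_)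
open import Data.Bool.Properties using (⇔→≡; ¬-not; ∨-zeroʳ; ∧-identityʳ)
open import Data.Empty using (⊥; ⊥-elim)
open import Data.Fin as Fin using (Fin; #_; toℕ; punchIn; punchOut)
import Data.Fin.Properties as Finₚ
open import Data.List using (List; []; _∷_; [_]; _++_; length; map; filter; allFin)
open import Data.List.Properties
  using (length-map; length-filter; filter-all; length-++; length-++-sucʳ; map-∘; map-id-local)
open import Data.List.Membership.Propositional using (_∈_)
open import Data.List.Membership.Propositional.Properties
  using (∈-∃++; ∈-filter⁺; ∈-filter⁻; ∈-map⁺; ∈-map⁻; ∈-++⁺ˡ; ∈-++⁺ʳ; ∈-++⁻; ∈-allFin)
import Data.List.Membership.DecPropositional as DecMembership
open import Data.List.Relation.Unary.All as All using (All; []; _∷_)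
open import Data.List.Relation.Unary.All.Properties.Core using (¬Any⇒All¬)
open import Data.List.Relation.Unary.Any using (here; there)
open import Data.List.Relation.Unary.Linked using (Linked; []; [-]; _∷_)
open import Data.List.Relation.Unary.Unique.Propositional using (Unique; []; _∷_)
import Data.List.Relation.Unary.Unique.Propositional.Properties as Unique
open import Data.Maybe using (Maybe; just; nothing; maybe)
import Data.Maybe.Properties as Maybe
open import Data.Nat as ℕ using (ℕ; zero; suc; _+_; _≤_; z≤n; s≤s)
open import Data.Nat.Properties using (≤-refl; ≤-trans; ≤-reflexive; 1+n≰n; n≤1⇒n≡0∨n≡1)
open import Data.Product using (Σ; _×_; _,_; proj₁; proj₂)
open import Data.Sum as Sum using (_⊎_; inj₁; inj₂; [_,_]′)
open import Data.Sum.Properties using (inj₁-injective; inj₂-injective)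
open import Data.Unit using (tt)
open import Data.Vec using (lookup; _∷_; [])
open import Function using (_∘_)
open import Function.Bundles using (_⇔_; mk⇔; Equivalence)
open import Relation.Binary using (DecidableEquality)
open import Relation.Binary.Construct.Closure.ReflexiveTransitive as Star using (Star; ε; _◅_; _◅◅_)
open import Relation.Binary.PropositionalEquality using (_≡_; _≢_; refl; sym; trans; cong; cong₂; subst)
open import Relation.Nullary using (¬_; Dec; yes; no; ¬?)
open import Relation.Nullary.Decidable
  using (⌊_⌋; True; toWitness; map′; _×-dec_; _⊎-dec_; _→-dec_)

-- Walks, detours and cycles

walk⇒star : {V : Set} {E : Rel V} {x y : V} → Walk E x y → Star (Adj E) x y
walk⇒star here       = ε
walk⇒star (step e w) = e ◅ walk⇒star w

star⇒walk : {V : Set} {E : Rel V} {x y : V} → Star (Adj E) x y → Walk E x y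
star⇒walk ε       = here
star⇒walk (e ◅ w) = step e (star⇒walk w)

adj-sym : {V : Set} {E : Rel V} → SymmetricRel E → ∀ {x y} → Adj E x y → Adj E y x
adj-sym E-sym {x} {y} e = trans (E-sym y x) e

connected-via : {V : Set} {E : Rel V} → SymmetricRel E → (r : V) →
                (∀ x → Star (Adj E) x r) → Connected E
connected-via E-sym r toR x y = star⇒walk (toR x ◅◅ Star.reverse (adj-sym E-sym) (toR y))

first-step : {V : Set} {R : V → V → Set} {x y : V} → Star R x y → x ≢ y → Σ V λ z → R x z
first-step ε        x≢x = ⊥-elim (x≢x refl)
first-step (r ◅ _) _   = _ , r

no-loop : ∀ {n} (G : Graph n) {x} → ¬ Adj (E G) x x
no-loop G {x} loop with trans (sym loop) (irrefl G x)
... | ()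

Avoiding : {V : Set} → Rel V → V → V → V → V → Set
Avoiding E x y a b = Adj E a b × ¬ (a ≡ y × b ≡ x)

Detour : {V : Set} → Rel V → V → V → Set
Detour E x y = Star (Avoiding E x y) y x

linked⇒star : {V : Set} {R : V → V → Set} {Q : V → Set} (a : V) (l : List V) (z : V) →
              Linked R (a ∷ l ++ [ z ]) → All Q (a ∷ l) → Star (λ s t → R s t × Q s) a z
linked⇒star a []      z (r ∷ [-]) (qa ∷ []) = (r , qa) ◅ ε
linked⇒star a (b ∷ l) z (r ∷ rs)  (qa ∷ qs) = (r , qa) ◅ linked⇒star b l z rs qs

cycle⇒detour : {V : Set} {E : Rel V} → Cycle E → Σ V λ x → Σ V λ y → Adj E x y × Detour E x y
cycle⇒detour (x , [] , () , _)
cycle⇒detour (x , y ∷ [] , s≤s () , _)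
cycle⇒detour {E = E} (x , y ∷ z ∷ zs , _ , (_ ∷ x≢z ∷ _) ∷ (y≢zzs ∷ _) , xy ∷ yz ∷ zx) =
  x , y , xy ,
  (yz , λ { (_ , z≡x) → x≢z (sym z≡x) }) ◅ Star.map avoid (linked⇒star z zs x zx (All.map ≢-sym y≢zzs))
  where
  ≢-sym : ∀ {a} → y ≢ a → ¬ a ≡ y
  ≢-sym y≢a a≡y = y≢a (sym a≡y)
  avoid : ∀ {a b} → Adj E a b × ¬ a ≡ y → Avoiding E x y a b
  avoid (e , a≢y) = e , λ { (a≡y , _) → a≢y a≡y }

module LoopErasure {V : Set} (R : V → V → Set) where

  data SimplePath : V → V → Set
  later : ∀ {a b} → SimplePath a b → List V

  data SimplePath where
    stop : ∀ {a} → SimplePath a a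
    go   : ∀ {a b c} → R a b → (p : SimplePath b c) → ¬ a ∈ (b ∷ later p) → SimplePath a c

  later stop                 = []
  later (go {b = b} _ p _)   = b ∷ later p

  suffix : ∀ {a b c} (p : SimplePath b c) → a ∈ (b ∷ later p) → SimplePath a c
  suffix p           (here refl)  = p
  suffix (go _ p _)  (there a∈p)  = suffix p a∈p

  erase : DecidableEquality V → ∀ {a c} → Star R a c → SimplePath a c
  erase _≟_ ε = stop
  erase _≟_ (_◅_ {a} {b} r w) with erase _≟_ w
  ... | p with DecMembership._∈?_ _≟_ a (b ∷ later p)
  ...   | yes a∈p = suffix p a∈p
  ...   | no  a∉p = go r p a∉p

  unique : ∀ {a c} (p : SimplePath a c) → Unique (a ∷ later p)
  unique stop                     = [] ∷ []
  unique (go {b = b} _ p a∉p)     = ¬Any⇒All¬ (b ∷ later p) a∉p ∷ unique p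

  linked : {R′ : V → V → Set} → (∀ {s t} → R s t → R′ s t) →
           ∀ {a c z} (p : SimplePath a c) → R′ c z → Linked R′ (a ∷ later p ++ [ z ])
  linked R⇒R′ stop       e = e ∷ [-]
  linked R⇒R′ (go r p _) e = R⇒R′ r ∷ linked R⇒R′ p e

detour⇒cycle : {V : Set} → DecidableEquality V → {E : Rel V} {x y : V} →
               Adj E x y → x ≢ y → Detour E x y → Cycle E
detour⇒cycle _≟_ {E} {x} {y} xy x≢y back = close (erase _≟_ back)
  where
  open LoopErasure (Avoiding E x y)
  close : SimplePath y x → Cycle E
  close stop                   = ⊥-elim (x≢y refl)
  close (go r stop _)          = ⊥-elim (proj₂ r (refl , refl))
  close p@(go _ (go _ _ _) _)  = y , later p , s≤s (s≤s z≤n) , unique p , linked proj₁ p xy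

-- Contracting a forest

Separated : {V′ V : Set} → Rel V′ → (V′ → V) → V′ → V′ → Set
Separated T′ f x y = Σ (_ → Bool) λ S → S x ≢ S y ×
  (∀ a b → Adj T′ a b → f a ≡ f x → f b ≡ f x → ¬ (a ≡ x × b ≡ y) → ¬ (a ≡ y × b ≡ x) → S a ≡ S b)

separated-swap : {V′ V : Set} {T′ : Rel V′} {f : V′ → V} {x y : V′} →
                 f x ≡ f y → Separated T′ f y x → Separated T′ f x y
separated-swap fx≡fy (S , Sy≢Sx , uncrossed) =
  S , (λ e → Sy≢Sx (sym e)) ,
  λ a b ab fa fb ¬xy ¬yx → uncrossed a b ab (trans fa fx≡fy) (trans fb fx≡fy) ¬yx ¬xy

-- A cycle of T′ through a kept edge maps to a cycle of T.  A cycle through a collapsed edge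
-- c d must cross its separating S a second time; no other edge inside the fibre does, so it
-- leaves the fibre from d's side and re-enters it on c's side, and the two kept edges it uses
-- (distinct, as S differs on them) close a cycle of T.
module Contraction {V′ V : Set} (_≟_ : DecidableEquality V) {T′ : Rel V′} {T : Rel V}
  (T′-sym : SymmetricRel T′) (f : V′ → V)
  (kept : ∀ {x y} → Adj T′ x y → f x ≢ f y → Adj T (f x) (f y))
  (kept-injective : ∀ {x y x′ y′} → Adj T′ x y → Adj T′ x′ y′ → f x ≢ f y →
                    f x ≡ f x′ → f y ≡ f y′ → x ≡ x′ × y ≡ y′)
  (collapsed : ∀ {x y} → Adj T′ x y → f x ≡ f y → Separated T′ f x y)
  where

  kept-detour : ∀ {c d s t} → Adj T′ c d → Star (Avoiding T′ c d) s t →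
                Star (Avoiding T (f c) (f d)) (f s) (f t)
  kept-detour cd ε = ε
  kept-detour {c} {d} {s} {t} cd (_◅_ {j = r} (sr , sr≢dc) w) with f s ≟ f r
  ... | yes fs≡fr = subst (λ z → Star (Avoiding T (f c) (f d)) z (f t)) (sym fs≡fr) (kept-detour cd w)
  ... | no  fs≢fr = (kept sr fs≢fr , λ { (fs≡fd , fr≡fc) →
                      sr≢dc (kept-injective sr (adj-sym T′-sym cd) fs≢fr fs≡fd fr≡fc) }) ◅ kept-detour cd w

  module Fibre {c d : V′} (S : V′ → Bool) (Sc≢Sd : S c ≢ S d)
    (uncrossed : ∀ a b → Adj T′ a b → f a ≡ f c → f b ≡ f c →
                 ¬ (a ≡ c × b ≡ d) → ¬ (a ≡ d × b ≡ c) → S a ≡ S b)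
    (T-acyclic : Acyclic T) where

    Outside : V → V → Set
    Outside a b = Adj T a b × b ≢ f c

    data Progress (s : V′) : Set where
      inside  : f s ≡ f c → S s ≡ S d → Progress s
      outside : ∀ {x y} → Adj T′ x y → f x ≡ f c → f y ≢ f c → S x ≡ S d →
                Star Outside (f y) (f s) → f s ≢ f c → Progress s

    re-enter : ∀ {x y s t} → Adj T′ x y → f x ≡ f c → f y ≢ f c → S x ≡ S d →
               Star Outside (f y) (f s) → f s ≢ f c → Adj T′ s t → f t ≡ f c → S t ≢ S d → ⊥
    re-enter {x} {y} {s} {t} xy fx≡fc fy≢fc Sx≡Sd out fs≢fc st ft≡fc St≢Sd =
      T-acyclic (detour⇒cycle _≟_ exit (λ e → fy≢fc (sym e)) (Star.map avoid out ◅◅ (entry ◅ ε)))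
      where
      fx≢fy : f x ≢ f y
      fx≢fy e = fy≢fc (trans (sym e) fx≡fc)
      exit : Adj T (f c) (f y)
      exit = subst (λ z → Adj T z (f y)) fx≡fc (kept xy fx≢fy)
      avoid : ∀ {a b} → Outside a b → Avoiding T (f c) (f y) a b
      avoid (e , b≢fc) = e , λ { (_ , b≡fc) → b≢fc b≡fc }
      same-edge : f s ≡ f y → x ≡ t
      same-edge fs≡fy = proj₂ (kept-injective (adj-sym T′-sym xy) st (λ e → fx≢fy (sym e))
                                               (sym fs≡fy) (trans fx≡fc (sym ft≡fc)))
      entry : Avoiding T (f c) (f y) (f s) (f c)
      entry = subst (Adj T (f s)) ft≡fc (kept st (λ e → fs≢fc (trans e ft≡fc))) ,
              λ { (fs≡fy , _) → St≢Sd (trans (cong S (sym (same-edge fs≡fy))) Sx≡Sd) }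

    follow : ∀ {s} → Star (Avoiding T′ c d) s c → Progress s → ⊥
    follow ε (inside _ Sc≡Sd)            = Sc≢Sd Sc≡Sd
    follow ε (outside _ _ _ _ _ fc≢fc)   = fc≢fc refl
    follow {s} (_◅_ {j = t} (st , st≢dc) w) (inside fs≡fc Ss≡Sd) with f t ≟ f c
    ... | yes ft≡fc = follow w (inside ft≡fc (trans (sym (uncrossed s t st fs≡fc ft≡fc
                                 (λ { (refl , _) → Sc≢Sd Ss≡Sd }) st≢dc)) Ss≡Sd))
    ... | no  ft≢fc = follow w (outside st fs≡fc ft≢fc Ss≡Sd ε ft≢fc)
    follow {s} (_◅_ {j = t} (st , _) w) (outside xy fx≡fc fy≢fc Sx≡Sd out fs≢fc) with f t ≟ f c
    ... | no ft≢fc with f s ≟ f t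
    ...   | yes fs≡ft = follow w (outside xy fx≡fc fy≢fc Sx≡Sd (subst (Star Outside _) fs≡ft out) ft≢fc)
    ...   | no  fs≢ft = follow w (outside xy fx≡fc fy≢fc Sx≡Sd (out ◅◅ ((kept st fs≢ft , ft≢fc) ◅ ε)) ft≢fc)
    follow {s} (_◅_ {j = t} (st , _) w) (outside xy fx≡fc fy≢fc Sx≡Sd out fs≢fc) | yes ft≡fc
      with S t Bool.≟ S d
    ... | yes St≡Sd = follow w (inside ft≡fc St≡Sd)
    ... | no  St≢Sd = re-enter xy fx≡fc fy≢fc Sx≡Sd out fs≢fc st ft≡fc St≢Sd

  acyclic : Acyclic T → Acyclic T′
  acyclic T-acyclic cyc with cycle⇒detour cyc
  ... | c , d , cd , back with f c ≟ f d
  ...   | no  fc≢fd = T-acyclic (detour⇒cycle _≟_ (kept cd fc≢fd) fc≢fd (kept-detour cd back))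
  ...   | yes fc≡fd with collapsed cd fc≡fd
  ...     | S , Sc≢Sd , uncrossed =
              Fibre.follow S Sc≢Sd uncrossed T-acyclic back (Fibre.inside (sym fc≡fd) refl)

-- Degrees

∈-delete : {A : Set} {x y : A} (l : List A) {r : List A} → x ∈ l ++ y ∷ r → x ≢ y → x ∈ l ++ r
∈-delete []      (here x≡y)  x≢y = ⊥-elim (x≢y x≡y)
∈-delete []      (there x∈r) _   = x∈r
∈-delete (a ∷ l) (here x≡a)  _   = here x≡a
∈-delete (a ∷ l) (there x∈l) x≢y = there (∈-delete l x∈l x≢y)

unique⊆⇒length≤ : {A : Set} {ys xs : List A} → Unique ys → (∀ {y} → y ∈ ys → y ∈ xs) →
                  length ys ≤ length xs
unique⊆⇒length≤ {ys = []}     _              _     = z≤n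
unique⊆⇒length≤ {ys = y ∷ ys} (y∉ys ∷ ys!) ys⊆xs with ∈-∃++ (ys⊆xs (here refl))
... | l , r , refl = ≤-trans (s≤s (unique⊆⇒length≤ ys! ys⊆lr)) (≤-reflexive (sym (length-++-sucʳ l y r)))
  where
  ys⊆lr : ∀ {z} → z ∈ ys → z ∈ l ++ r
  ys⊆lr z∈ys = ∈-delete l (ys⊆xs (there z∈ys)) (λ z≡y → All.lookup y∉ys z∈ys (sym z≡y))

distinct-neighbours-≤ : {V : Set} (E : Rel V) {v : V} {k : ℕ} {ys : List V} →
                        HasDegree E v k → Unique ys → All (Adj E v) ys → length ys ≤ k
distinct-neighbours-≤ E (ns , refl , _ , nbr) ys! adj =
  unique⊆⇒length≤ ys! (λ {y} y∈ys → Equivalence.to (nbr y) (All.lookup adj y∈ys))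

degree-≤ : {V : Set} (E : Rel V) {v : V} {k : ℕ} {xs : List V} →
           HasDegree E v k → (∀ w → Adj E v w → w ∈ xs) → k ≤ length xs
degree-≤ E (ns , refl , ns! , nbr) ⊆xs = unique⊆⇒length≤ ns! (λ {w} w∈ns → ⊆xs w (Equivalence.from (nbr w) w∈ns))

module NeighbourhoodImage {V V′ : Set} {E : Rel V} {E′ : Rel V′} {v : V} {v′ : V′} {k : ℕ}
  (g : V → V′) (h : V′ → V)
  (lift : ∀ {w′} → Adj E′ v′ w′ → Adj E v (h w′) × g (h w′) ≡ w′)
  (retract : ∀ {w} → Adj E v w → Adj E′ v′ (g w) → h (g w) ≡ w)
  (degree : HasDegree E v k)
  where

  private
    ns : List V
    ns = proj₁ degree
    |ns|≡k : length ns ≡ k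
    |ns|≡k = proj₁ (proj₂ degree)
    ns! : Unique ns
    ns! = proj₁ (proj₂ (proj₂ degree))
    nbr : ∀ w → Adj E v w ⇔ (w ∈ ns)
    nbr = proj₂ (proj₂ (proj₂ degree))

    survives? : ∀ w → Dec (Adj E′ v′ (g w))
    survives? w = E′ v′ (g w) Bool.≟ true

    survivors : List V
    survivors = filter survives? ns

    survivor : ∀ {w} → w ∈ survivors → Adj E v w × Adj E′ v′ (g w)
    survivor w∈ = let (w∈ns , gw) = ∈-filter⁻ survives? w∈ in Equivalence.from (nbr _) w∈ns , gw

  image : List V′
  image = map g survivors

  hasDegree : HasDegree E′ v′ (length image)
  hasDegree = image , refl , image! , λ w′ → mk⇔ (to w′) (from w′)
    where
    h∘g : map h image ≡ survivors
    h∘g = trans (sym (map-∘ survivors))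
                (map-id-local (All.tabulate (λ w∈ → let (vw , gw) = survivor w∈ in retract vw gw)))
    image! : Unique image
    image! = Unique.map⁻ (subst Unique (sym h∘g) (Unique.filter⁺ survives? ns!))
    to : ∀ w′ → Adj E′ v′ w′ → w′ ∈ image
    to w′ vw′ = let (vhw′ , ghw′≡w′) = lift vw′ in
      subst (_∈ image) ghw′≡w′ (∈-map⁺ g (∈-filter⁺ survives? (Equivalence.to (nbr _) vhw′)
                                           (subst (Adj E′ v′) (sym ghw′≡w′) vw′)))
    from : ∀ w′ → w′ ∈ image → Adj E′ v′ w′
    from w′ w′∈ with ∈-map⁻ g w′∈
    ... | w , w∈ , refl = proj₂ (survivor w∈)

  length≤ : length image ≤ k
  length≤ = subst (length image ≤_) |ns|≡k
              (≤-trans (≤-reflexive (length-map g survivors)) (length-filter survives? ns))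

  length≡ : (∀ {w} → Adj E v w → Adj E′ v′ (g w)) → length image ≡ k
  length≡ forward = trans (length-map g survivors) (trans (cong length (filter-all survives? all-survive)) |ns|≡k)
    where
    all-survive : All (λ w → Adj E′ v′ (g w)) ns
    all-survive = All.tabulate (λ w∈ → forward (Equivalence.from (nbr _) w∈))

-- Decompositions as edge colourings

data Part : Set where
  tree cycle matching : Part

_≟ᴾ_ : DecidableEquality Part
tree     ≟ᴾ tree     = yes refl
cycle    ≟ᴾ cycle    = yes refl
matching ≟ᴾ matching = yes refl
tree     ≟ᴾ cycle    = no λ ()
tree     ≟ᴾ matching = no λ ()
cycle    ≟ᴾ tree     = no λ ()
cycle    ≟ᴾ matching = no λ ()
matching ≟ᴾ tree     = no λ ()
matching ≟ᴾ cycle    = no λ ()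

record Colouring {V : Set} (E : Rel V) : Set where
  field
    colour    : Part → Rel V
    symmetric : ∀ k → SymmetricRel (colour k)
    ⊆E        : ∀ k {x y} → Adj (colour k) x y → Adj E x y
    cover     : ∀ {x y} → Adj E x y → Σ Part λ k → Adj (colour k) x y
    disjoint  : ∀ k l {x y} → Adj (colour k) x y → Adj (colour l) x y → k ≡ l

fromThreeDecomposition : {V : Set} {E : Rel V} → ThreeDecomposition E → Colouring E
fromThreeDecomposition {E = E} D = record
  { colour = colour ; symmetric = symmetric ; ⊆E = ⊆E ; cover = cover ; disjoint = disjoint }
  where
  open ThreeDecomposition D hiding (cover)
  colour : Part → Rel _
  colour tree     = T
  colour cycle    = C
  colour matching = M
  symmetric : ∀ k → SymmetricRel (colour k)
  symmetric tree     = T-sym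
  symmetric cycle    = C-sym
  symmetric matching = M-sym
  ⊆E : ∀ k {x y} → Adj (colour k) x y → Adj E x y
  ⊆E tree     = T⊆E _ _
  ⊆E cycle    = C⊆E _ _
  ⊆E matching = M⊆E _ _
  cover : ∀ {x y} → Adj E x y → Σ Part λ k → Adj (colour k) x y
  cover xy with ThreeDecomposition.cover D _ _ xy
  ... | inj₁ t        = tree , t
  ... | inj₂ (inj₁ c) = cycle , c
  ... | inj₂ (inj₂ m) = matching , m
  disjoint : ∀ k l {x y} → Adj (colour k) x y → Adj (colour l) x y → k ≡ l
  disjoint tree     tree     _ _ = refl
  disjoint cycle    cycle    _ _ = refl
  disjoint matching matching _ _ = refl
  disjoint tree     cycle    t c = ⊥-elim (TC-disj _ _ t c)
  disjoint tree     matching t m = ⊥-elim (TM-disj _ _ t m)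
  disjoint cycle    tree     c t = ⊥-elim (TC-disj _ _ t c)
  disjoint cycle    matching c m = ⊥-elim (CM-disj _ _ c m)
  disjoint matching tree     m t = ⊥-elim (TM-disj _ _ t m)
  disjoint matching cycle    m c = ⊥-elim (CM-disj _ _ c m)

toThreeDecomposition : {V : Set} {E : Rel V} (c : Colouring E) → let open Colouring c in
  SpanningTree (colour tree) → TwoRegular (colour cycle) → Matching (colour matching) →
  ThreeDecomposition E
toThreeDecomposition c tree-spans cycle-2reg matching-match = record
  { T = colour tree ; C = colour cycle ; M = colour matching
  ; T-sym = symmetric tree ; C-sym = symmetric cycle ; M-sym = symmetric matching
  ; T⊆E = λ _ _ → ⊆E tree ; C⊆E = λ _ _ → ⊆E cycle ; M⊆E = λ _ _ → ⊆E matching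
  ; cover = λ _ _ xy → split (cover xy)
  ; TC-disj = λ _ _ t c → tree≢cycle (disjoint tree cycle t c)
  ; TM-disj = λ _ _ t m → tree≢matching (disjoint tree matching t m)
  ; CM-disj = λ _ _ c m → cycle≢matching (disjoint cycle matching c m)
  ; T-tree = tree-spans ; C-2reg = cycle-2reg ; M-match = matching-match
  }
  where
  open Colouring c
  split : ∀ {x y} → Σ Part (λ k → Adj (colour k) x y) →
          Adj (colour tree) x y ⊎ Adj (colour cycle) x y ⊎ Adj (colour matching) x y
  split (tree , t)     = inj₁ t
  split (cycle , c)    = inj₂ (inj₁ c)
  split (matching , m) = inj₂ (inj₂ m)
  tree≢cycle : tree ≢ cycle
  tree≢cycle ()
  tree≢matching : tree ≢ matching
  tree≢matching ()
  cycle≢matching : cycle ≢ matching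
  cycle≢matching ()







-- The Petersen gadgets

∧-true : ∀ {x y} → x ∧ y ≡ true → x ≡ true × y ≡ true
∧-true {true} {true} _ = refl , refl

∨-true : ∀ {x y} → x ∨ y ≡ true → x ≡ true ⊎ y ≡ true
∨-true {true}  _ = inj₁ refl
∨-true {false} e = inj₂ e

isYes⇒ : {A : Set} (a? : Dec A) → ⌊ a? ⌋ ≡ true → A
isYes⇒ (yes a) _ = a

isYes-true : {A : Set} (a? : Dec A) → A → ⌊ a? ⌋ ≡ true
isYes-true (yes _) _ = refl
isYes-true (no ¬a) a = ⊥-elim (¬a a)

isYes-false : {A : Set} (a? : Dec A) → ¬ A → ⌊ a? ⌋ ≡ false
isYes-false (yes a) ¬a = ⊥-elim (¬a a)
isYes-false (no _)  _  = refl

data Port : Set where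
  i₁ i₂ i₃ : Port

_≟ᵢ_ : DecidableEquality Port
i₁ ≟ᵢ i₁ = yes refl
i₂ ≟ᵢ i₂ = yes refl
i₃ ≟ᵢ i₃ = yes refl
i₁ ≟ᵢ i₂ = no λ ()
i₁ ≟ᵢ i₃ = no λ ()
i₂ ≟ᵢ i₁ = no λ ()
i₂ ≟ᵢ i₃ = no λ ()
i₃ ≟ᵢ i₁ = no λ ()
i₃ ≟ᵢ i₂ = no λ ()

tri : {A : Set} → A → A → A → Port → A
tri a b c i₁ = a
tri a b c i₂ = b
tri a b c i₃ = c

port : Port → Fin 9
port = tri p₁ p₂ p₃

portAt : Fin 9 → Maybe Port
portAt q = if ⌊ q Fin.≟ p₁ ⌋ then just i₁ else if ⌊ q Fin.≟ p₂ ⌋ then just i₂ else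
           if ⌊ q Fin.≟ p₃ ⌋ then just i₃ else nothing

portAt-port : ∀ i → portAt (port i) ≡ just i
portAt-port i₁ = refl
portAt-port i₂ = refl
portAt-port i₃ = refl

port-injective : ∀ {i j} → port i ≡ port j → i ≡ j
port-injective {i} {j} e =
  Maybe.just-injective (trans (sym (portAt-port i)) (trans (cong portAt e) (portAt-port j)))

∀-Port? : {P : Port → Set} → (∀ i → Dec (P i)) → Dec (∀ i → P i)
∀-Port? P? = map′ (λ { (a , b , c) i₁ → a ; (a , b , c) i₂ → b ; (a , b , c) i₃ → c })
                  (λ ∀P → ∀P i₁ , ∀P i₂ , ∀P i₃) (P? i₁ ×-dec P? i₂ ×-dec P? i₃)

∀-Part? : {P : Part → Set} → (∀ k → Dec (P k)) → Dec (∀ k → P k)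
∀-Part? P? = map′ (λ { (t , c , m) tree → t ; (t , c , m) cycle → c ; (t , c , m) matching → m })
                  (λ ∀P → ∀P tree , ∀P cycle , ∀P matching) (P? tree ×-dec P? cycle ×-dec P? matching)

∃-Part? : {P : Part → Set} → (∀ k → Dec (P k)) → Dec (Σ Part P)
∃-Part? P? = map′ (λ { (inj₁ t) → tree , t ; (inj₂ (inj₁ c)) → cycle , c ; (inj₂ (inj₂ m)) → matching , m })
                  (λ { (tree , t) → inj₁ t ; (cycle , c) → inj₂ (inj₁ c) ; (matching , m) → inj₂ (inj₂ m) })
                  (P? tree ⊎-dec P? cycle ⊎-dec P? matching)

portAt⇒port : ∀ q {i} → portAt q ≡ just i → q ≡ port i
portAt⇒port q {i} = toWitness {a? = check} tt q i
  where
  check : Dec (∀ q i → portAt q ≡ just i → q ≡ port i)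
  check = Finₚ.all? λ q → ∀-Port? λ i → Maybe.≡-dec _≟ᵢ_ (portAt q) (just i) →-dec q Fin.≟ port i

-- A colouring of P and of the links p_i w_i.  Every vertex of P is contracted onto u, except the optional leaf p_i:
-- the tree reaches it only through its link, and it is contracted onto w_i.
record Gadget : Set where
  field
    link          : Port → Part
    parent        : Fin 9 → Fin 9
    root          : Fin 9
    leaf          : Maybe Port
    cycleEdges    : List (ℕ × ℕ)
    matchingEdges : List (ℕ × ℕ)

  inner : Part → Rel (Fin 9)
  inner tree     q r = not ⌊ q Fin.≟ r ⌋ ∧ (⌊ parent q Fin.≟ r ⌋ ∨ ⌊ parent r Fin.≟ q ⌋)
  inner cycle    q r = edgeℕ cycleEdges (toℕ q) (toℕ r)
  inner matching q r = edgeℕ matchingEdges (toℕ q) (toℕ r)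

  innerNeighbours : Part → Fin 9 → List (Fin 9)
  innerNeighbours k q = filter (λ r → inner k q r Bool.≟ true) (allFin 9)

  linkPorts : Part → Fin 9 → List Port
  linkPorts k q = maybe (λ i → if ⌊ link i ≟ᴾ k ⌋ then [ i ] else []) [] (portAt q)

  degree : Part → Fin 9 → ℕ
  degree k q = length (innerNeighbours k q) + length (linkPorts k q)

  atU : Fin 9 → Bool
  atU q = maybe (λ i → not ⌊ q Fin.≟ port i ⌋) true leaf

  reaches : ℕ → Fin 9 → Bool
  reaches zero    q = ⌊ q Fin.≟ root ⌋
  reaches (suc n) q = ⌊ q Fin.≟ root ⌋ ∨ (inner tree q (parent q) ∧ reaches n (parent q))

  ancestor : ℕ → Fin 9 → Fin 9 → Bool
  ancestor zero    c v = ⌊ c Fin.≟ v ⌋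
  ancestor (suc n) c v = ⌊ c Fin.≟ v ⌋ ∨ ancestor n c (parent v)

  lower : Fin 9 → Fin 9 → Fin 9
  lower q r = if ⌊ parent q Fin.≟ r ⌋ then q else r

  below : Fin 9 → Fin 9 → Fin 9 → Bool
  below q r = ancestor 9 (lower q r)

  Cuts : Fin 9 → Fin 9 → Set
  Cuts q r = below q r q ≢ below q r r ×
    (∀ a b → Adj (inner tree) a b → ¬ (a ≡ q × b ≡ r) → ¬ (a ≡ r × b ≡ q) → below q r a ≡ below q r b)

  ¬atU⇒leaf : ∀ {q} → atU q ≡ false → Σ Port λ i → leaf ≡ just i × q ≡ port i
  ¬atU⇒leaf {q} e with leaf
  ... | just i with q Fin.≟ port i
  ...   | yes q≡ = i , refl , q≡

  leaf⇒¬atU : ∀ {i} → leaf ≡ just i → atU (port i) ≡ false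
  leaf⇒¬atU {i} e rewrite e | isYes-true (port i Fin.≟ port i) refl = refl

  linkPorts⇒ : ∀ {k q i} → i ∈ linkPorts k q → q ≡ port i × link i ≡ k
  linkPorts⇒ {k} {q} i∈ with portAt q in eq
  ... | just j with link j ≟ᴾ k
  linkPorts⇒ {k} {q} (here refl) | just j | yes lj≡k = portAt⇒port q eq , lj≡k

  linkPorts⇐ : ∀ {k q i} → q ≡ port i → link i ≡ k → i ∈ linkPorts k q
  linkPorts⇐ {i = i} refl refl rewrite portAt-port i | isYes-true (link i ≟ᴾ link i) refl = here refl

  linkPorts-unique : ∀ k q → Unique (linkPorts k q)
  linkPorts-unique k q with portAt q
  ... | nothing = []
  ... | just j with link j ≟ᴾ k
  ...   | yes _ = [] ∷ []
  ...   | no  _ = []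

record Valid (g : Gadget) (profile : Port → Part) : Set where
  open Gadget g
  field
    inner-sym       : ∀ k q r → Adj (inner k) q r → Adj (inner k) r q
    inner⊆P         : ∀ k q r → Adj (inner k) q r → Adj petersenMinus q r
    P⊆inner         : ∀ q r → Adj petersenMinus q r → Σ Part λ k → Adj (inner k) q r
    inner-disjoint  : ∀ k l q r → Adj (inner k) q r → Adj (inner l) q r → k ≡ l
    cycle-degree    : ∀ q → degree cycle q ≡ 0 ⊎ degree cycle q ≡ 2
    matching-degree : ∀ q → degree matching q ≡ 0 ⊎ degree matching q ≡ 1
    tree⇒atU        : ∀ q r → Adj (inner tree) q r → atU q ≡ true
    atU⇒reaches     : ∀ q → atU q ≡ true → reaches 8 q ≡ true
    leaf-link       : ∀ i → leaf ≡ just i → link i ≡ tree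
    link-cycle      : ∀ i → link i ≡ cycle → profile i ≡ cycle
    cycle-link      : ∀ i → profile i ≡ cycle → link i ≡ cycle
    link-matching   : ∀ i → link i ≡ matching → profile i ≡ matching
    tree-link       : ∀ i → profile i ≡ tree → link i ≡ tree × atU (port i) ≡ true
    link-tree       : ∀ i → link i ≡ tree → atU (port i) ≡ true → profile i ≡ tree
    tree-cuts       : ∀ q r → Adj (inner tree) q r → Cuts q r

valid? : ∀ g profile → Dec (Valid g profile)
valid? g profile = map′
  (λ (c₁ , c₂ , c₃ , c₄ , c₅ , c₆ , c₇ , c₈ , c₉ , c₁₀ , c₁₁ , c₁₂ , c₁₃ , c₁₄ , c₁₅) → record
    { inner-sym = c₁ ; inner⊆P = c₂ ; P⊆inner = c₃ ; inner-disjoint = c₄ ; cycle-degree = c₅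
    ; matching-degree = c₆ ; tree⇒atU = c₇ ; atU⇒reaches = c₈ ; leaf-link = c₉ ; link-cycle = c₁₀
    ; cycle-link = c₁₁ ; link-matching = c₁₂ ; tree-link = c₁₃ ; link-tree = c₁₄ ; tree-cuts = c₁₅ })
  (λ v → let open Valid v in
    inner-sym , inner⊆P , P⊆inner , inner-disjoint , cycle-degree , matching-degree , tree⇒atU ,
    atU⇒reaches , leaf-link , link-cycle , cycle-link , link-matching , tree-link , link-tree , tree-cuts)
  ( (∀-Part? λ k → Finₚ.all? λ q → Finₚ.all? λ r → ✓? (inner k q r) →-dec ✓? (inner k r q))
  ×-dec (∀-Part? λ k → Finₚ.all? λ q → Finₚ.all? λ r → ✓? (inner k q r) →-dec ✓? (petersenMinus q r))
  ×-dec (Finₚ.all? λ q → Finₚ.all? λ r → ✓? (petersenMinus q r) →-dec ∃-Part? λ k → ✓? (inner k q r))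
  ×-dec (∀-Part? λ k → ∀-Part? λ l → Finₚ.all? λ q → Finₚ.all? λ r →
           ✓? (inner k q r) →-dec ✓? (inner l q r) →-dec k ≟ᴾ l)
  ×-dec (Finₚ.all? λ q → degree cycle q ℕ.≟ 0 ⊎-dec degree cycle q ℕ.≟ 2)
  ×-dec (Finₚ.all? λ q → degree matching q ℕ.≟ 0 ⊎-dec degree matching q ℕ.≟ 1)
  ×-dec (Finₚ.all? λ q → Finₚ.all? λ r → ✓? (inner tree q r) →-dec ✓? (atU q))
  ×-dec (Finₚ.all? λ q → ✓? (atU q) →-dec ✓? (reaches 8 q))
  ×-dec (∀-Port? λ i → Maybe.≡-dec _≟ᵢ_ leaf (just i) →-dec link i ≟ᴾ tree)
  ×-dec (∀-Port? λ i → link i ≟ᴾ cycle →-dec profile i ≟ᴾ cycle)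
  ×-dec (∀-Port? λ i → profile i ≟ᴾ cycle →-dec link i ≟ᴾ cycle)
  ×-dec (∀-Port? λ i → link i ≟ᴾ matching →-dec profile i ≟ᴾ matching)
  ×-dec (∀-Port? λ i → profile i ≟ᴾ tree →-dec (link i ≟ᴾ tree ×-dec ✓? (atU (port i))))
  ×-dec (∀-Port? λ i → link i ≟ᴾ tree →-dec ✓? (atU (port i)) →-dec profile i ≟ᴾ tree)
  ×-dec (Finₚ.all? λ q → Finₚ.all? λ r → ✓? (inner tree q r) →-dec cuts? q r))
  where
  open Gadget g
  ✓? : (b : Bool) → Dec (b ≡ true)
  ✓? b = b Bool.≟ true
  cuts? : ∀ q r → Dec (Cuts q r)
  cuts? q r = ¬? (below q r q Bool.≟ below q r r) ×-dec
    (Finₚ.all? λ a → Finₚ.all? λ b → ✓? (inner tree a b) →-dec ¬? (a Fin.≟ q ×-dec b Fin.≟ r) →-dec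
                           ¬? (a Fin.≟ r ×-dec b Fin.≟ q) →-dec below q r a Bool.≟ below q r b)

ValidGadget : (Port → Part) → Set
ValidGadget profile = Σ Gadget λ g → Valid g profile

certify : (profile : Port → Part) (g : Gadget) → {_ : True (valid? g profile)} → ValidGadget profile
certify profile g {ok} = g , toWitness ok

gadgetTTT : ValidGadget (tri tree tree tree)
gadgetTTT = certify _ record
  { link = tri tree tree tree ; parent = lookup (# 0 ∷ # 0 ∷ # 1 ∷ # 2 ∷ # 7 ∷ # 8 ∷ # 1 ∷ # 5 ∷ # 6 ∷ [])
  ; root = # 0 ; leaf = nothing
  ; cycleEdges = [] ; matchingEdges = (0 , 5) ∷ (2 , 7) ∷ (3 , 8) ∷ (4 , 6) ∷ [] }

gadgetTCC : ValidGadget (tri tree cycle cycle)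
gadgetTCC = certify _ record
  { link = tri tree cycle cycle ; parent = lookup (# 0 ∷ # 0 ∷ # 1 ∷ # 2 ∷ # 6 ∷ # 0 ∷ # 1 ∷ # 2 ∷ # 6 ∷ [])
  ; root = # 0 ; leaf = nothing
  ; cycleEdges = (3 , 8) ∷ (8 , 5) ∷ (5 , 7) ∷ (7 , 4) ∷ [] ; matchingEdges = [] }

gadgetCTC : ValidGadget (tri cycle tree cycle)
gadgetCTC = certify _ record
  { link = tri cycle tree cycle ; parent = lookup (# 0 ∷ # 0 ∷ # 1 ∷ # 2 ∷ # 6 ∷ # 8 ∷ # 1 ∷ # 2 ∷ # 3 ∷ [])
  ; root = # 0 ; leaf = nothing
  ; cycleEdges = (0 , 5) ∷ (5 , 7) ∷ (7 , 4) ∷ [] ; matchingEdges = (6 , 8) ∷ [] }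

gadgetCCT : ValidGadget (tri cycle cycle tree)
gadgetCCT = certify _ record
  { link = tri cycle cycle tree ; parent = lookup (# 0 ∷ # 0 ∷ # 1 ∷ # 2 ∷ # 6 ∷ # 7 ∷ # 1 ∷ # 2 ∷ # 6 ∷ [])
  ; root = # 0 ; leaf = nothing
  ; cycleEdges = (0 , 5) ∷ (3 , 8) ∷ (8 , 5) ∷ [] ; matchingEdges = (7 , 4) ∷ [] }

gadgetMTT : ValidGadget (tri matching tree tree)
gadgetMTT = certify _ record
  { link = tri tree tree tree ; parent = lookup (# 0 ∷ # 1 ∷ # 1 ∷ # 2 ∷ # 7 ∷ # 7 ∷ # 4 ∷ # 2 ∷ # 3 ∷ [])
  ; root = # 1 ; leaf = just i₁
  ; cycleEdges = (0 , 1) ∷ (0 , 5) ∷ (1 , 6) ∷ (6 , 8) ∷ (8 , 5) ∷ [] ; matchingEdges = [] }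

gadgetTMT : ValidGadget (tri tree matching tree)
gadgetTMT = certify _ record
  { link = tri tree tree tree ; parent = lookup (# 0 ∷ # 0 ∷ # 1 ∷ # 3 ∷ # 6 ∷ # 0 ∷ # 1 ∷ # 4 ∷ # 6 ∷ [])
  ; root = # 0 ; leaf = just i₂
  ; cycleEdges = (2 , 3) ∷ (2 , 7) ∷ (3 , 8) ∷ (8 , 5) ∷ (5 , 7) ∷ [] ; matchingEdges = [] }

gadgetTTM : ValidGadget (tri tree tree matching)
gadgetTTM = certify _ record
  { link = tri tree tree tree ; parent = lookup (# 0 ∷ # 0 ∷ # 1 ∷ # 2 ∷ # 4 ∷ # 0 ∷ # 1 ∷ # 2 ∷ # 3 ∷ [])
  ; root = # 0 ; leaf = just i₃
  ; cycleEdges = (4 , 6) ∷ (6 , 8) ∷ (8 , 5) ∷ (5 , 7) ∷ (7 , 4) ∷ [] ; matchingEdges = [] }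

-- Replacing u by a gadget

module Replacement (m : ℕ) (G : Graph (suc m)) (cubic : Cubic G) (D : ThreeDecomposition (E G))
  (u : Fin (suc m)) (w₁ w₂ w₃ : Fin m)
  (uw₁ : Adj (E G) u (punchIn u w₁)) (uw₂ : Adj (E G) u (punchIn u w₂)) (uw₃ : Adj (E G) u (punchIn u w₃))
  (w₁≢w₂ : w₁ ≢ w₂) (w₁≢w₃ : w₁ ≢ w₃) (w₂≢w₃ : w₂ ≢ w₃)
  where

  open Colouring (fromThreeDecomposition D)
  open ThreeDecomposition D using (T-tree; C-2reg; M-match)

  H : Rel (Fin m ⊎ Fin 9)
  H = replacePetersen G u w₁ w₂ w₃

  toG : Fin m → Fin (suc m)
  toG = punchIn u

  toG-injective : ∀ {a b} → toG a ≡ toG b → a ≡ b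
  toG-injective = Finₚ.punchIn-injective u _ _

  toG≢u : ∀ a → toG a ≢ u
  toG≢u = Finₚ.punchInᵢ≢i u

  w : Port → Fin m
  w = tri w₁ w₂ w₃

  w-injective : ∀ {i j} → w i ≡ w j → i ≡ j
  w-injective {i₁} {i₁} _ = refl
  w-injective {i₂} {i₂} _ = refl
  w-injective {i₃} {i₃} _ = refl
  w-injective {i₁} {i₂} e = ⊥-elim (w₁≢w₂ e)
  w-injective {i₁} {i₃} e = ⊥-elim (w₁≢w₃ e)
  w-injective {i₂} {i₃} e = ⊥-elim (w₂≢w₃ e)
  w-injective {i₂} {i₁} e = ⊥-elim (w₁≢w₂ (sym e))
  w-injective {i₃} {i₁} e = ⊥-elim (w₁≢w₃ (sym e))
  w-injective {i₃} {i₂} e = ⊥-elim (w₂≢w₃ (sym e))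

  toG∘w-≢ : ∀ {i j} → i ≢ j → toG (w i) ≢ toG (w j)
  toG∘w-≢ i≢j e = i≢j (w-injective (toG-injective e))

  u-adj : ∀ i → Adj (E G) u (toG (w i))
  u-adj i₁ = uw₁
  u-adj i₂ = uw₂
  u-adj i₃ = uw₃

  neighbour-of-u : ∀ {v} → Adj (E G) u v → Σ Port λ i → v ≡ toG (w i)
  neighbour-of-u {v} uv with v Fin.≟ toG (w i₁) | v Fin.≟ toG (w i₂) | v Fin.≟ toG (w i₃)
  ... | yes e | _     | _     = i₁ , e
  ... | no _  | yes e | _     = i₂ , e
  ... | no _  | no _  | yes e = i₃ , e
  ... | no n₁ | no n₂ | no n₃ = ⊥-elim (1+n≰n (distinct-neighbours-≤ (E G) (cubic u) four-distinct
                                  (uv ∷ u-adj i₁ ∷ u-adj i₂ ∷ u-adj i₃ ∷ [])))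
    where
    four-distinct : Unique (v ∷ toG (w i₁) ∷ toG (w i₂) ∷ toG (w i₃) ∷ [])
    four-distinct = (n₁ ∷ n₂ ∷ n₃ ∷ []) ∷ (toG∘w-≢ (λ ()) ∷ toG∘w-≢ (λ ()) ∷ []) ∷
                    (toG∘w-≢ (λ ()) ∷ []) ∷ [] ∷ []

  H-link⇒ : ∀ {a q} → Adj H (inj₁ a) (inj₂ q) → Σ Port λ i → q ≡ port i × a ≡ w i
  H-link⇒ {a} {q} e with ∨-true e
  ... | inj₁ e₁ = let (a≡ , q≡) = ∧-true e₁ in i₁ , isYes⇒ (q Fin.≟ p₁) q≡ , isYes⇒ (a Fin.≟ w₁) a≡
  ... | inj₂ e₂₃ with ∨-true e₂₃
  ...   | inj₁ e₂ = let (a≡ , q≡) = ∧-true e₂ in i₂ , isYes⇒ (q Fin.≟ p₂) q≡ , isYes⇒ (a Fin.≟ w₂) a≡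
  ...   | inj₂ e₃ = let (a≡ , q≡) = ∧-true e₃ in i₃ , isYes⇒ (q Fin.≟ p₃) q≡ , isYes⇒ (a Fin.≟ w₃) a≡

  H-link⇐ : ∀ i → Adj H (inj₁ (w i)) (inj₂ (port i))
  H-link⇐ i₁ rewrite isYes-true (w₁ Fin.≟ w₁) refl = refl
  H-link⇐ i₂ rewrite isYes-true (w₂ Fin.≟ w₂) refl = ∨-zeroʳ _
  H-link⇐ i₃ rewrite isYes-true (w₃ Fin.≟ w₃) refl | ∨-zeroʳ (⌊ w₃ Fin.≟ w₂ ⌋ ∧ false) = ∨-zeroʳ _

  -- The port facing a; junk (i₃) unless a is one of w₁, w₂, w₃.
  portOf : Fin m → Port
  portOf a = if ⌊ a Fin.≟ w₁ ⌋ then i₁ else if ⌊ a Fin.≟ w₂ ⌋ then i₂ else i₃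

  portOf-w : ∀ i → portOf (w i) ≡ i
  portOf-w i₁ rewrite isYes-true (w₁ Fin.≟ w₁) refl = refl
  portOf-w i₂ rewrite isYes-false (w₂ Fin.≟ w₁) (w₁≢w₂ ∘ sym) | isYes-true (w₂ Fin.≟ w₂) refl = refl
  portOf-w i₃ rewrite isYes-false (w₃ Fin.≟ w₁) (w₁≢w₃ ∘ sym) | isYes-false (w₃ Fin.≟ w₂) (w₂≢w₃ ∘ sym) = refl

  -- Neighbours of an old vertex a, moved from G to H: u becomes the port vertex facing a.
  toH : Fin m → Fin (suc m) → Fin m ⊎ Fin 9
  toH a v with u Fin.≟ v
  ... | yes _   = inj₂ (port (portOf a))
  ... | no u≢v  = inj₁ (punchOut u≢v)

  fromH : Fin m ⊎ Fin 9 → Fin (suc m)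
  fromH (inj₁ b) = toG b
  fromH (inj₂ _) = u

  fromH-toH : ∀ a v → fromH (toH a v) ≡ v
  fromH-toH a v with u Fin.≟ v
  ... | yes u≡v = u≡v
  ... | no  u≢v = Finₚ.punchIn-punchOut u≢v

  toH-toG : ∀ a b → toH a (toG b) ≡ inj₁ b
  toH-toG a b with u Fin.≟ toG b
  ... | yes u≡ = ⊥-elim (toG≢u b (sym u≡))
  ... | no  u≢ = cong inj₁ (trans (Finₚ.punchOut-cong u refl) (Finₚ.punchOut-punchIn u))

  toH-u : ∀ i → toH (w i) u ≡ inj₂ (port i)
  toH-u i with u Fin.≟ u
  ... | yes _ = cong (inj₂ ∘ port) (portOf-w i)
  ... | no u≢u = ⊥-elim (u≢u refl)

  record IsProfile (profile : Port → Part) : Set where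
    constructor is-profile
    field
      coloured-as : ∀ i → Adj (colour (profile i)) u (toG (w i))

  module Constraints {profile : Port → Part} (prof : IsProfile profile) where
    open IsProfile prof

    colour-at-u : ∀ {k i} → Adj (colour k) u (toG (w i)) → k ≡ profile i
    colour-at-u {k} {i} e = disjoint k (profile i) e (coloured-as i)

    coloured : ∀ {k i} → profile i ≡ k → Adj (colour k) u (toG (w i))
    coloured refl = coloured-as _

    some-tree : Σ Port λ i → profile i ≡ tree
    some-tree with first-step (walk⇒star (proj₁ T-tree u (toG (w i₁)))) (λ e → toG≢u _ (sym e))
    ... | y , uy with neighbour-of-u (⊆E tree uy)
    ...   | i , refl = i , sym (colour-at-u uy)

    two-matching : ∀ {i j} → i ≢ j → profile i ≡ matching → profile j ≡ matching → ⊥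
    two-matching {i} {j} i≢j mi mj =
      [ (λ none → 1+n≰n (≤-trans (two≤ none) z≤n)) , (λ one → 1+n≰n (two≤ one)) ]′ (M-match u)
      where
      two≤ : ∀ {d} → HasDegree (colour matching) u d → 2 ≤ d
      two≤ deg = distinct-neighbours-≤ (colour matching) deg ((toG∘w-≢ i≢j ∷ []) ∷ [] ∷ [])
                                       (coloured mi ∷ coloured mj ∷ [])

    lone-cycle : ∀ {i} → profile i ≡ cycle → (∀ j → profile j ≡ cycle → j ≡ i) → ⊥
    lone-cycle {i} ci only with C-2reg u
    ... | inj₁ none = 1+n≰n (distinct-neighbours-≤ (colour cycle) none ([] ∷ []) (coloured ci ∷ []))
    ... | inj₂ two  = 1+n≰n (degree-≤ (colour cycle) two within)
      where
      within : ∀ v → Adj (colour cycle) u v → v ∈ [ toG (w i) ]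
      within v uv with neighbour-of-u (⊆E cycle uv)
      ... | j , refl = here (cong (toG ∘ w) (only j (sym (colour-at-u uv))))

  no-tree : ∀ {t₁ t₂ t₃} → t₁ ≢ tree → t₂ ≢ tree → t₃ ≢ tree → ¬ Σ Port (λ i → tri t₁ t₂ t₃ i ≡ tree)
  no-tree n₁ _  _  (i₁ , e) = n₁ e
  no-tree _  n₂ _  (i₂ , e) = n₂ e
  no-tree _  _  n₃ (i₃ , e) = n₃ e

  gadgetFor : (t₁ t₂ t₃ : Part) → IsProfile (tri t₁ t₂ t₃) → ValidGadget (tri t₁ t₂ t₃)
  gadgetFor tree     tree     tree     _ = gadgetTTT
  gadgetFor tree     cycle    cycle    _ = gadgetTCC
  gadgetFor cycle    tree     cycle    _ = gadgetCTC
  gadgetFor cycle    cycle    tree     _ = gadgetCCT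
  gadgetFor matching tree     tree     _ = gadgetMTT
  gadgetFor tree     matching tree     _ = gadgetTMT
  gadgetFor tree     tree     matching _ = gadgetTTM
  gadgetFor tree     tree     cycle    f = ⊥-elim (Constraints.lone-cycle f refl λ { i₃ _ → refl ; i₁ () ; i₂ () })
  gadgetFor tree     matching cycle    f = ⊥-elim (Constraints.lone-cycle f refl λ { i₃ _ → refl ; i₁ () ; i₂ () })
  gadgetFor matching tree     cycle    f = ⊥-elim (Constraints.lone-cycle f refl λ { i₃ _ → refl ; i₁ () ; i₂ () })
  gadgetFor tree     cycle    tree     f = ⊥-elim (Constraints.lone-cycle f refl λ { i₂ _ → refl ; i₁ () ; i₃ () })
  gadgetFor tree     cycle    matching f = ⊥-elim (Constraints.lone-cycle f refl λ { i₂ _ → refl ; i₁ () ; i₃ () })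
  gadgetFor matching cycle    tree     f = ⊥-elim (Constraints.lone-cycle f refl λ { i₂ _ → refl ; i₁ () ; i₃ () })
  gadgetFor cycle    tree     tree     f = ⊥-elim (Constraints.lone-cycle f refl λ { i₁ _ → refl ; i₂ () ; i₃ () })
  gadgetFor cycle    tree     matching f = ⊥-elim (Constraints.lone-cycle f refl λ { i₁ _ → refl ; i₂ () ; i₃ () })
  gadgetFor cycle    matching tree     f = ⊥-elim (Constraints.lone-cycle f refl λ { i₁ _ → refl ; i₂ () ; i₃ () })
  gadgetFor tree     matching matching f = ⊥-elim (Constraints.two-matching f {i₂} {i₃} (λ ()) refl refl)
  gadgetFor matching tree     matching f = ⊥-elim (Constraints.two-matching f {i₁} {i₃} (λ ()) refl refl)
  gadgetFor matching matching tree     f = ⊥-elim (Constraints.two-matching f {i₁} {i₂} (λ ()) refl refl)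
  gadgetFor cycle    cycle    cycle    f = ⊥-elim (no-tree (λ ()) (λ ()) (λ ()) (Constraints.some-tree f))
  gadgetFor cycle    cycle    matching f = ⊥-elim (no-tree (λ ()) (λ ()) (λ ()) (Constraints.some-tree f))
  gadgetFor cycle    matching cycle    f = ⊥-elim (no-tree (λ ()) (λ ()) (λ ()) (Constraints.some-tree f))
  gadgetFor matching cycle    cycle    f = ⊥-elim (no-tree (λ ()) (λ ()) (λ ()) (Constraints.some-tree f))
  gadgetFor cycle    matching matching f = ⊥-elim (no-tree (λ ()) (λ ()) (λ ()) (Constraints.some-tree f))
  gadgetFor matching cycle    matching f = ⊥-elim (no-tree (λ ()) (λ ()) (λ ()) (Constraints.some-tree f))
  gadgetFor matching matching cycle    f = ⊥-elim (no-tree (λ ()) (λ ()) (λ ()) (Constraints.some-tree f))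
  gadgetFor matching matching matching f = ⊥-elim (no-tree (λ ()) (λ ()) (λ ()) (Constraints.some-tree f))

  module Build {profile : Port → Part} (prof : IsProfile profile) (g : Gadget) (valid : Valid g profile) where
    open IsProfile prof
    open Gadget g
    open Valid valid
    open Constraints prof using (colour-at-u; coloured)

    V′ : Set
    V′ = Fin m ⊎ Fin 9

    linkColour : Part → Fin m → Fin 9 → Bool
    linkColour k a q = H (inj₁ a) (inj₂ q) ∧ maybe (λ i → ⌊ link i ≟ᴾ k ⌋) false (portAt q)

    colourH : Part → Rel V′
    colourH k (inj₁ a) (inj₁ b) = colour k (toG a) (toG b)
    colourH k (inj₂ q) (inj₂ r) = inner k q r
    colourH k (inj₁ a) (inj₂ q) = linkColour k a q
    colourH k (inj₂ q) (inj₁ a) = linkColour k a q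

    link-colour⇒ : ∀ {k a q} → Adj (colourH k) (inj₁ a) (inj₂ q) →
                   Σ Port λ i → q ≡ port i × a ≡ w i × link i ≡ k
    link-colour⇒ {k} {a} {q} e with ∧-true {H (inj₁ a) (inj₂ q)} e
    ... | aq , lk with H-link⇒ {a} {q} aq
    ...   | i , refl , refl = i , refl , refl ,
            isYes⇒ (link i ≟ᴾ k) (subst (λ p → maybe (λ j → ⌊ link j ≟ᴾ k ⌋) false p ≡ true) (portAt-port i) lk)

    link-colour⇐ : ∀ {k i} → link i ≡ k → Adj (colourH k) (inj₁ (w i)) (inj₂ (port i))
    link-colour⇐ {i = i} refl rewrite portAt-port i | isYes-true (link i ≟ᴾ link i) refl =
      trans (∧-identityʳ _) (H-link⇐ i)

    symmetricH : ∀ k → SymmetricRel (colourH k)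
    symmetricH k (inj₁ a) (inj₁ b) = symmetric k (toG a) (toG b)
    symmetricH k (inj₂ q) (inj₂ r) = ⇔→≡ (mk⇔ (inner-sym k q r) (inner-sym k r q))
    symmetricH k (inj₁ a) (inj₂ q) = refl
    symmetricH k (inj₂ q) (inj₁ a) = refl

    ⊆H : ∀ k {x y} → Adj (colourH k) x y → Adj H x y
    ⊆H k {inj₁ a} {inj₁ b} e = ⊆E k e
    ⊆H k {inj₂ q} {inj₂ r} e = inner⊆P k q r e
    ⊆H k {inj₁ a} {inj₂ q} e = proj₁ (∧-true {H (inj₁ a) (inj₂ q)} e)
    ⊆H k {inj₂ q} {inj₁ a} e = proj₁ (∧-true {H (inj₁ a) (inj₂ q)} e)

    coverH : ∀ {x y} → Adj H x y → Σ Part λ k → Adj (colourH k) x y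
    coverH {inj₁ a} {inj₁ b} e = cover e
    coverH {inj₂ q} {inj₂ r} e = P⊆inner q r e
    coverH {inj₁ a} {inj₂ q} e with H-link⇒ {a} {q} e
    ... | i , refl , refl = link i , link-colour⇐ {i = i} refl
    coverH {inj₂ q} {inj₁ a} e with H-link⇒ {a} {q} e
    ... | i , refl , refl = link i , link-colour⇐ {i = i} refl

    link-disjoint : ∀ k l {a q} → Adj (colourH k) (inj₁ a) (inj₂ q) → Adj (colourH l) (inj₁ a) (inj₂ q) → k ≡ l
    link-disjoint k l {a} {q} e f with link-colour⇒ {k} {a} {q} e | link-colour⇒ {l} {a} {q} f
    ... | i , refl , _ , refl | j , pi≡pj , _ , refl = cong link (port-injective pi≡pj)

    disjointH : ∀ k l {x y} → Adj (colourH k) x y → Adj (colourH l) x y → k ≡ l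
    disjointH k l {inj₁ a} {inj₁ b} = disjoint k l
    disjointH k l {inj₂ q} {inj₂ r} = inner-disjoint k l q r
    disjointH k l {inj₁ a} {inj₂ q} = link-disjoint k l {a} {q}
    disjointH k l {inj₂ q} {inj₁ a} = link-disjoint k l {a} {q}

    colouringH : Colouring H
    colouringH = record
      { colour = colourH ; symmetric = symmetricH ; ⊆E = λ k {x} {y} → ⊆H k {x} {y}
      ; cover = λ {x} {y} → coverH {x} {y} ; disjoint = λ k l {x} {y} → disjointH k l {x} {y} }

    profile-link : ∀ i → link i ≢ tree → profile i ≡ link i
    profile-link i ≢tree with link i | link-cycle i | link-matching i
    ... | tree     | _  | _  = ⊥-elim (≢tree refl)
    ... | cycle    | lc | _  = lc refl
    ... | matching | _  | lm = lm refl

    lift : ∀ k → k ≢ tree → ∀ {a x} → Adj (colourH k) (inj₁ a) x →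
           Adj (colour k) (toG a) (fromH x) × toH a (fromH x) ≡ x
    lift k _ {a} {inj₁ b} ab = ab , toH-toG a b
    lift k k≢tree {a} {inj₂ q} aq with link-colour⇒ {k} {a} {q} aq
    ... | i , refl , refl , refl =
      adj-sym (symmetric (link i)) (coloured (profile-link i k≢tree)) , toH-u i

    module Image (k : Part) (k≢tree : k ≢ tree) (a : Fin m) {d : ℕ} (deg : HasDegree (colour k) (toG a) d) =
      NeighbourhoodImage {E = colour k} {E′ = colourH k} {v = toG a} {v′ = inj₁ a}
        (toH a) fromH (lift k k≢tree) (λ _ _ → fromH-toH a _) deg

    cycle-forward : ∀ a {v} → Adj (colour cycle) (toG a) v → Adj (colourH cycle) (inj₁ a) (toH a v)
    cycle-forward a {v} av with u Fin.≟ v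
    ... | no u≢v = subst (Adj (colour cycle) (toG a)) (sym (Finₚ.punchIn-punchOut u≢v)) av
    ... | yes refl with neighbour-of-u (⊆E cycle (adj-sym (symmetric cycle) av))
    ...   | i , toGa≡ with toG-injective toGa≡
    ...     | refl = subst (λ j → Adj (colourH cycle) (inj₁ (w i)) (inj₂ (port j))) (sym (portOf-w i))
                       (link-colour⇐ {i = i} (cycle-link i (sym (colour-at-u (adj-sym (symmetric cycle) av)))))

    cycle-old : ∀ a {d} → HasDegree (colour cycle) (toG a) d → HasDegree (colourH cycle) (inj₁ a) d
    cycle-old a deg = subst (HasDegree (colourH cycle) (inj₁ a)) (length≡ (cycle-forward a)) hasDegree
      where open Image cycle (λ ()) a deg

    matching-old : ∀ a {d} → d ≤ 1 → HasDegree (colour matching) (toG a) d →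
                   HasDegree (colourH matching) (inj₁ a) 0 ⊎ HasDegree (colourH matching) (inj₁ a) 1
    matching-old a d≤1 deg = Sum.map (λ e → subst (HasDegree (colourH matching) (inj₁ a)) e hasDegree)
                                     (λ e → subst (HasDegree (colourH matching) (inj₁ a)) e hasDegree)
                                     (n≤1⇒n≡0∨n≡1 (≤-trans length≤ d≤1))
      where open Image matching (λ ()) a deg

    new-degree : ∀ k q → HasDegree (colourH k) (inj₂ q) (degree k q)
    new-degree k q = ns , len , ns! , λ x → mk⇔ (to x) (from x)
      where
      adjacent? : ∀ r → Dec (Adj (inner k) q r)
      adjacent? r = inner k q r Bool.≟ true
      ns : List V′
      ns = map inj₂ (innerNeighbours k q) ++ map (inj₁ ∘ w) (linkPorts k q)
      len : length ns ≡ degree k q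
      len = trans (length-++ (map inj₂ (innerNeighbours k q)))
                  (cong₂ _+_ (length-map inj₂ (innerNeighbours k q)) (length-map (inj₁ ∘ w) (linkPorts k q)))
      apart : ∀ {x} → ¬ (x ∈ map inj₂ (innerNeighbours k q) × x ∈ map (inj₁ ∘ w) (linkPorts k q))
      apart (x∈₁ , x∈₂) with ∈-map⁻ inj₂ x∈₁ | ∈-map⁻ (inj₁ ∘ w) x∈₂
      ... | _ , _ , refl | _ , _ , ()
      ns! : Unique ns
      ns! = Unique.++⁺ (Unique.map⁺ inj₂-injective (Unique.filter⁺ adjacent? (Unique.allFin⁺ 9)))
                       (Unique.map⁺ (w-injective ∘ inj₁-injective) (linkPorts-unique k q)) apart
      to : ∀ x → Adj (colourH k) (inj₂ q) x → x ∈ ns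
      to (inj₂ r) e = ∈-++⁺ˡ (∈-map⁺ inj₂ (∈-filter⁺ adjacent? (∈-allFin r) e))
      to (inj₁ a) e with link-colour⇒ {k} {a} {q} e
      ... | i , q≡ , refl , lk = ∈-++⁺ʳ (map inj₂ (innerNeighbours k q)) (∈-map⁺ (inj₁ ∘ w) (linkPorts⇐ q≡ lk))
      from : ∀ x → x ∈ ns → Adj (colourH k) (inj₂ q) x
      from x x∈ with ∈-++⁻ (map inj₂ (innerNeighbours k q)) x∈
      ... | inj₁ x∈₁ with ∈-map⁻ inj₂ x∈₁
      ...   | r , r∈ , refl = proj₂ (∈-filter⁻ adjacent? r∈)
      from x x∈ | inj₂ x∈₂ with ∈-map⁻ (inj₁ ∘ w) x∈₂
      ...   | i , i∈ , refl with linkPorts⇒ i∈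
      ...     | q≡ , lk = subst (λ p → Adj (colourH k) (inj₂ p) (inj₁ (w i))) (sym q≡) (link-colour⇐ {i = i} lk)

    new-degree-≡ : ∀ k q {d} → degree k q ≡ d → HasDegree (colourH k) (inj₂ q) d
    new-degree-≡ k q e = subst (HasDegree (colourH k) (inj₂ q)) e (new-degree k q)

    cycle-2regular : TwoRegular (colourH cycle)
    cycle-2regular (inj₁ a) = Sum.map (cycle-old a) (cycle-old a) (C-2reg (toG a))
    cycle-2regular (inj₂ q) = Sum.map (new-degree-≡ cycle q) (new-degree-≡ cycle q) (cycle-degree q)

    matching-matching : Matching (colourH matching)
    matching-matching (inj₁ a) = [ matching-old a z≤n , matching-old a ≤-refl ]′ (M-match (toG a))
    matching-matching (inj₂ q) = Sum.map (new-degree-≡ matching q) (new-degree-≡ matching q) (matching-degree q)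

    TH : Rel V′
    TH = colourH tree

    climb : ∀ n q → reaches n q ≡ true → Star (Adj TH) (inj₂ q) (inj₂ root)
    climb zero q e with q Fin.≟ root
    ... | yes refl = ε
    climb (suc n) q e with q Fin.≟ root
    ... | yes refl = ε
    ... | no _ = let (q-up , up-reaches) = ∧-true {inner tree q (parent q)} e in
                 q-up ◅ climb n (parent q) up-reaches

    enter : ∀ {v} → Star (Adj (colour tree)) v u → ∀ a → v ≡ toG a →
            Σ (Fin 9) λ q → atU q ≡ true × Star (Adj TH) (inj₁ a) (inj₂ q)
    enter ε a u≡ = ⊥-elim (toG≢u a (sym u≡))
    enter (_◅_ {j = v} e walk) a refl with u Fin.≟ v
    ... | yes refl with neighbour-of-u (⊆E tree (adj-sym (symmetric tree) e))
    ...   | i , toGa≡ with toG-injective toGa≡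
    ...     | refl with tree-link i (sym (colour-at-u (adj-sym (symmetric tree) e)))
    ...       | lt , atU-i = port i , atU-i , link-colour⇐ {i = i} lt ◅ ε
    enter (_◅_ {j = v} e walk) a refl | no u≢v with enter walk (punchOut u≢v) (sym (Finₚ.punchIn-punchOut u≢v))
    ... | q , atU-q , rest =
      q , atU-q , subst (Adj (colour tree) (toG a)) (sym (Finₚ.punchIn-punchOut u≢v)) e ◅ rest

    old-to-root : ∀ a → Star (Adj TH) (inj₁ a) (inj₂ root)
    old-to-root a with enter (walk⇒star (proj₁ T-tree (toG a) u)) a refl
    ... | q , atU-q , walk = walk ◅◅ climb 8 q (atU⇒reaches q atU-q)

    to-root : ∀ x → Star (Adj TH) x (inj₂ root)
    to-root (inj₁ a) = old-to-root a
    to-root (inj₂ q) with atU q in atU-q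
    ... | true  = climb 8 q (atU⇒reaches q atU-q)
    ... | false with ¬atU⇒leaf {q} atU-q
    ...   | i , leaf≡i , refl = link-colour⇐ {i = i} (leaf-link i leaf≡i) ◅ old-to-root (w i)

    contract : V′ → Fin (suc m)
    contract (inj₁ a) = toG a
    contract (inj₂ q) = if atU q then u else maybe (toG ∘ w) u leaf

    contract-atU : ∀ q → atU q ≡ true → contract (inj₂ q) ≡ u
    contract-atU q atU-q rewrite atU-q = refl

    contract-leaf : ∀ {i} → leaf ≡ just i → contract (inj₂ (port i)) ≡ toG (w i)
    contract-leaf leaf≡i rewrite leaf⇒¬atU leaf≡i | leaf≡i = refl

    data KeptEdge : V′ → V′ → Set where
      old  : ∀ a b → KeptEdge (inj₁ a) (inj₁ b)
      up   : ∀ i → atU (port i) ≡ true → profile i ≡ tree → KeptEdge (inj₁ (w i)) (inj₂ (port i))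
      down : ∀ i → atU (port i) ≡ true → profile i ≡ tree → KeptEdge (inj₂ (port i)) (inj₁ (w i))

    kept-link : ∀ {a q} → Adj TH (inj₁ a) (inj₂ q) → toG a ≢ contract (inj₂ q) →
                Σ Port λ i → a ≡ w i × q ≡ port i × atU (port i) ≡ true × profile i ≡ tree
    kept-link {a} {q} e c≢ with link-colour⇒ {tree} {a} {q} e
    ... | i , refl , refl , lt = i , refl , refl , atU-i , link-tree i lt atU-i
      where
      not-leaf : atU (port i) ≢ false
      not-leaf ¬atU-i with ¬atU⇒leaf {port i} ¬atU-i
      ... | j , leaf≡j , pi≡pj with port-injective pi≡pj
      ...   | refl = c≢ (sym (contract-leaf leaf≡j))
      atU-i : atU (port i) ≡ true
      atU-i = ¬-not not-leaf

    kept-edge : ∀ {x y} → Adj TH x y → contract x ≢ contract y → KeptEdge x y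
    kept-edge {inj₁ a} {inj₁ b} _ _ = old a b
    kept-edge {inj₂ q} {inj₂ r} e c≢ =
      ⊥-elim (c≢ (trans (contract-atU q (tree⇒atU q r e))
                        (sym (contract-atU r (tree⇒atU r q (inner-sym tree q r e))))))
    kept-edge {inj₁ a} {inj₂ q} e c≢ with kept-link {a} {q} e c≢
    ... | i , refl , refl , atU-i , pt = up i atU-i pt
    kept-edge {inj₂ q} {inj₁ a} e c≢ with kept-link {a} {q} e (c≢ ∘ sym)
    ... | i , refl , refl , atU-i , pt = down i atU-i pt

    kept : ∀ {x y} → Adj TH x y → contract x ≢ contract y → Adj (colour tree) (contract x) (contract y)
    kept {x} {y} e c≢ with kept-edge {x} {y} e c≢
    ... | old a b = e
    ... | up i atU-i pt =
      subst (Adj (colour tree) (toG (w i))) (sym (contract-atU (port i) atU-i))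
            (adj-sym (symmetric tree) (coloured pt))
    ... | down i atU-i pt =
      subst (λ z → Adj (colour tree) z (toG (w i))) (sym (contract-atU (port i) atU-i)) (coloured pt)

    same-kept : ∀ {x y x′ y′} → KeptEdge x y → KeptEdge x′ y′ →
                contract x ≡ contract x′ → contract y ≡ contract y′ → x ≡ x′ × y ≡ y′
    same-kept (old a b)      (old a′ b′)     e₁ e₂ = cong inj₁ (toG-injective e₁) , cong inj₁ (toG-injective e₂)
    same-kept (old a b)      (up i atU-i _)   _ e₂ = ⊥-elim (toG≢u b (trans e₂ (contract-atU (port i) atU-i)))
    same-kept (old a b)      (down i atU-i _) e₁ _ = ⊥-elim (toG≢u a (trans e₁ (contract-atU (port i) atU-i)))
    same-kept (up i atU-i _)   (old a b)      _ e₂ = ⊥-elim (toG≢u b (trans (sym e₂) (contract-atU (port i) atU-i)))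
    same-kept (down i atU-i _) (old a b)      e₁ _ = ⊥-elim (toG≢u a (trans (sym e₁) (contract-atU (port i) atU-i)))
    same-kept (up i _ _)     (down j atU-j _) e₁ _ = ⊥-elim (toG≢u (w i) (trans e₁ (contract-atU (port j) atU-j)))
    same-kept (down i _ _)   (up j atU-j _)   _ e₂ = ⊥-elim (toG≢u (w i) (trans e₂ (contract-atU (port j) atU-j)))
    same-kept (up i _ _)     (up j _ _)       e₁ _ with w-injective (toG-injective e₁)
    ... | refl = refl , refl
    same-kept (down i _ _)   (down j _ _)     _ e₂ with w-injective (toG-injective e₂)
    ... | refl = refl , refl

    kept-injective : ∀ {x y x′ y′} → Adj TH x y → Adj TH x′ y′ → contract x ≢ contract y →
                     contract x ≡ contract x′ → contract y ≡ contract y′ → x ≡ x′ × y ≡ y′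
    kept-injective {x} {y} {x′} {y′} xy x′y′ c≢ e₁ e₂ =
      same-kept (kept-edge {x} {y} xy c≢)
                (kept-edge {x′} {y′} x′y′ (λ e → c≢ (trans e₁ (trans e (sym e₂))))) e₁ e₂

    inner-separated : ∀ q r → Adj (inner tree) q r → Separated TH contract (inj₂ q) (inj₂ r)
    inner-separated q r e with tree-cuts q r e
    ... | apart , uncut = S , apart , uncrossed
      where
      S : V′ → Bool
      S (inj₁ _) = false
      S (inj₂ v) = below q r v
      u≡ : contract (inj₂ q) ≡ u
      u≡ = contract-atU q (tree⇒atU q r e)
      uncrossed : ∀ x y → Adj TH x y → contract x ≡ contract (inj₂ q) → contract y ≡ contract (inj₂ q) →
                  ¬ (x ≡ inj₂ q × y ≡ inj₂ r) → ¬ (x ≡ inj₂ r × y ≡ inj₂ q) → S x ≡ S y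
      uncrossed (inj₁ a) _ _ ca _ _ _ = ⊥-elim (toG≢u a (trans ca u≡))
      uncrossed (inj₂ _) (inj₁ b) _ _ cb _ _ = ⊥-elim (toG≢u b (trans cb u≡))
      uncrossed (inj₂ a) (inj₂ b) ab _ _ ¬qr ¬rq =
        uncut a b ab (λ { (refl , refl) → ¬qr (refl , refl) }) (λ { (refl , refl) → ¬rq (refl , refl) })

    link-separated : ∀ {a q} → Adj TH (inj₁ a) (inj₂ q) → Separated TH contract (inj₁ a) (inj₂ q)
    link-separated {a} {q} e = old? , (λ ()) , uncrossed
      where
      old? : V′ → Bool
      old? (inj₁ _) = true
      old? (inj₂ _) = false
      same-link : ∀ {a′ q′} → Adj TH (inj₁ a′) (inj₂ q′) → a′ ≡ a → q′ ≡ q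
      same-link {a′} {q′} e′ refl with link-colour⇒ {tree} {a} {q} e | link-colour⇒ {tree} {a′} {q′} e′
      ... | i , refl , a≡ , _ | j , refl , a≡′ , _ with w-injective (trans (sym a≡′) a≡)
      ...   | refl = refl
      uncrossed : ∀ x y → Adj TH x y → contract x ≡ toG a → contract y ≡ toG a →
                  ¬ (x ≡ inj₁ a × y ≡ inj₂ q) → ¬ (x ≡ inj₂ q × y ≡ inj₁ a) → old? x ≡ old? y
      uncrossed (inj₁ _) (inj₁ _) _ _ _ _ _ = refl
      uncrossed (inj₂ _) (inj₂ _) _ _ _ _ _ = refl
      uncrossed (inj₁ a′) (inj₂ q′) e′ ca′ _ ¬aq _ =
        ⊥-elim (¬aq (cong inj₁ (toG-injective ca′) , cong inj₂ (same-link {a′} {q′} e′ (toG-injective ca′))))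
      uncrossed (inj₂ q′) (inj₁ a′) e′ _ ca′ _ ¬qa =
        ⊥-elim (¬qa (cong inj₂ (same-link {a′} {q′} e′ (toG-injective ca′)) , cong inj₁ (toG-injective ca′)))

    collapsed : ∀ {x y} → Adj TH x y → contract x ≡ contract y → Separated TH contract x y
    collapsed {inj₁ a} {inj₁ b} e c≡ with toG-injective c≡
    ... | refl = ⊥-elim (no-loop G (⊆E tree e))
    collapsed {inj₂ q} {inj₂ r} e _  = inner-separated q r e
    collapsed {inj₁ a} {inj₂ q} e _  = link-separated {a} {q} e
    collapsed {inj₂ q} {inj₁ a} e c≡ = separated-swap c≡ (link-separated {a} {q} e)

    tree-acyclic : Acyclic TH
    tree-acyclic = Contraction.acyclic Fin._≟_ (symmetricH tree) contract
                     (λ {x} {y} → kept {x} {y}) (λ {x} {y} {x′} {y′} → kept-injective {x} {y} {x′} {y′})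
                     (λ {x} {y} → collapsed {x} {y}) (proj₂ T-tree)

    decomposition : ThreeDecomposition H
    decomposition = toThreeDecomposition colouringH
      (connected-via (symmetricH tree) (inj₂ root) to-root , tree-acyclic) cycle-2regular matching-matching

  colourAt : Port → Part
  colourAt i = proj₁ (cover (u-adj i))

  profile-at-u : IsProfile (tri (colourAt i₁) (colourAt i₂) (colourAt i₃))
  profile-at-u = is-profile λ { i₁ → proj₂ (cover (u-adj i₁))
                              ; i₂ → proj₂ (cover (u-adj i₂))
                              ; i₃ → proj₂ (cover (u-adj i₃)) }

  decomposition : ThreeDecomposition H
  decomposition with gadgetFor (colourAt i₁) (colourAt i₂) (colourAt i₃) profile-at-u
  ... | g , valid = Build.decomposition profile-at-u g valid

lemma18 : (m : ℕ) (G : Graph (suc m)) → Cubic G → ThreeDecomposition (E G) →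
          (u : Fin (suc m)) (w₁ w₂ w₃ : Fin m) →
          E G u (punchIn u w₁) ≡ true → E G u (punchIn u w₂) ≡ true →
          E G u (punchIn u w₃) ≡ true →
          w₁ ≢ w₂ → w₁ ≢ w₃ → w₂ ≢ w₃ →
          ThreeDecomposition (replacePetersen G u w₁ w₂ w₃)
lemma18 = Replacement.decomposition
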